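{- Let $M\ge 1$ be an integer. For every integer $r\ge 1$ and every non-prime integer $k$ with $r\le k\le Mr$, $$\operatorname{Pr}(r,k)\le \left(1-\frac{1}{M}\right)^{\pi(k)},$$ where $$\operatorname{Pr}(r,k)=M^{ -r}\cdot\#\Big\{(\eta_1,\ldots,\eta_r)\in\{1,\ldots,M\}^r:\ \textstyle\sum_{i=1}^{\ell}\eta_i\notin\mathbb{P}\text{ for all }1\le\ell<r,\ \sum_{i=1}^r\eta_i=k\Big\}.$$
   Context: $\mathbb{P}$ is the set of prime numbers and $\pi(x)$ denotes the number of primes less than or equal to $x$. -}

module Defs where

open import Data.Nat using (ℕ; zero; suc; _+_; _*_; _^_; _≤_; _<_; s≤s; z≤n)
open import Data.Nat.Properties using (_≟_)
open import Data.Nat.Primality using (Prime; prime?)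
open import Data.List using (List; []; _∷_; map; concatMap; length; filter; applyUpTo)
open import Data.Vec using (Vec; []; _∷_; sum)
open import Data.Product using (_×_; _,_)
open import Data.Empty using (⊥-elim)
open import Relation.Binary.PropositionalEquality using (_≡_)
open import Relation.Nullary using (¬_; Dec; yes; no)
open import Relation.Nullary.Decidable using (_×-dec_)

oneTo : ℕ → List ℕ
oneTo M = applyUpTo suc M

tuples : (M r : ℕ) → List (Vec ℕ r)
tuples M zero    = [] ∷ []
tuples M (suc r) = concatMap (λ x → map (x ∷_) (tuples M r)) (oneTo M)

partialSum : ∀ {r} → ℕ → Vec ℕ r → ℕ
partialSum zero    _        = 0
partialSum (suc ℓ) []       = 0
partialSum (suc ℓ) (x ∷ xs) = x + partialSum ℓ xs

NoPrimePrefix : ∀ {r} → Vec ℕ r → Set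
NoPrimePrefix {r} η = ∀ ℓ → 1 ≤ ℓ → ℓ < r → ¬ Prime (partialSum ℓ η)

Good : ∀ {r} → ℕ → Vec ℕ r → Set
Good k η = NoPrimePrefix η × sum η ≡ k

private
  below? : ∀ {r} (η : Vec ℕ r) (n : ℕ) →
           Dec (∀ ℓ → 1 ≤ ℓ → ℓ < n → ¬ Prime (partialSum ℓ η))
  below? η zero = yes (λ ℓ _ ())
  below? η (suc zero) = yes λ { zero () _ ; (suc ℓ) _ (s≤s ()) }
  below? η (suc (suc n)) with below? η (suc n) | prime? (partialSum (suc n) η)
  ... | no ¬h | _ = no (λ h → ¬h (λ ℓ p q → h ℓ p (lift q)))
    where
      lift : ∀ {a b} → a < b → a < suc b
      lift (s≤s z≤n) = s≤s z≤n
      lift (s≤s (s≤s q)) = s≤s (lift (s≤s q))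
  ... | yes _ | yes pr = no (λ h → h (suc n) (s≤s z≤n) (s≤s (s≤s (refl≤ n))) pr)
    where
      refl≤ : ∀ m → m ≤ m
      refl≤ zero = z≤n
      refl≤ (suc m) = s≤s (refl≤ m)
  ... | yes h | no np = yes (λ ℓ p q → go ℓ p q)
    where
      go : ∀ ℓ → 1 ≤ ℓ → ℓ < suc (suc n) → ¬ Prime (partialSum ℓ η)
      go ℓ p q with ℓ ≟ suc n
      ... | yes Relation.Binary.PropositionalEquality.refl = np
      ... | no ℓ≢ = h ℓ p (shrink ℓ n q ℓ≢)
        where
          shrink : ∀ a m → a < suc (suc m) → ¬ a ≡ suc m → a < suc m
          shrink zero m _ _ = s≤s z≤n
          shrink (suc a) zero (s≤s (s≤s z≤n)) ne = ⊥-elim (ne Relation.Binary.PropositionalEquality.refl)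
          shrink (suc a) (suc m) (s≤s q) ne =
            s≤s (shrink a m q (λ e → ne (Relation.Binary.PropositionalEquality.cong suc e)))

good? : ∀ {r} (k : ℕ) (η : Vec ℕ r) → Dec (Good k η)
good? {r} k η = below? η r ×-dec (sum η ≟ k)

countGood : (M r k : ℕ) → ℕ
countGood M r k = length (filter (good? k) (tuples M r))

primeCount : ℕ → ℕ
primeCount x = length (filter prime? (applyUpTo suc x))

open import Data.Nat using (NonZero)
open import Data.Nat.Properties using (m^n≢0)
open import Data.Integer using (+_)
open import Data.Rational as ℚ using (ℚ; 1ℚ)

_^ℚ_ : ℚ → ℕ → ℚ
q ^ℚ zero  = 1ℚ
q ^ℚ suc n = q ℚ.* (q ^ℚ n)

Pr : (M : ℕ) .{{_ : NonZero M}} → (r k : ℕ) → ℚ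
Pr M r k = (+ countGood M r k) ℚ./ (M ^ r)
  where instance _ = m^n≢0 M r

oneMinusInv : (M : ℕ) .{{_ : NonZero M}} → ℚ
oneMinusInv M = 1ℚ ℚ.- ((+ 1) ℚ./ M)

-- Generalise to walks started anywhere: let W_n(s) count the walks of n steps in {1,…,M} from s
-- whose positions avoid primes and that end at k, and let e(s) be the number of primes in (s, k].
-- Then W_n(s) · M^e(s) ≤ M^n (M − 1)^e(s), by induction on n, since W_{n+1}(s) is the sum of
-- W_n(s + i) over the non-prime s + i with 1 ≤ i ≤ M. Add up the bounds for these terms from
-- i = 1 upwards: a prime s + i ≤ k contributes nothing, and every later bound is larger by the
-- factor M/(M − 1); with m terms still to come this is paid for because m·M ≤ (m + 1)(M − 1)
-- for m < M. The tuples counted by Pr(r,k) are such walks from 0, and e(0) = π(k).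

module Submission where

open import Defs
open import Data.Bool using (if_then_else_)
open import Data.Integer as ℤ using ()
open import Data.Integer.Properties using (pos-*)
open import Data.List as List using (List; []; _∷_; map; concatMap; length; filter; applyUpTo)
open import Data.List.Properties
  using (length-++; filter-++; filter-accept; filter-reject; applyUpTo-∷ʳ; map-applyUpTo)
open import Data.List.Relation.Binary.Sublist.Heterogeneous.Properties using (length-mono-≤)
open import Data.List.Relation.Binary.Sublist.Propositional using (⊆-refl)
open import Data.List.Relation.Binary.Sublist.Propositional.Properties using (filter⁺)
open import Data.Nat using (ℕ; zero; suc; _+_; _*_; _^_; _∸_; _≤_; z≤n; s≤s; NonZero)
open import Data.Nat.ListAction using (sum)
open import Data.Nat.Properties
open import Algebra.Properties.CommutativeSemigroup +-commutativeSemigroup using (x∙yz≈yx∙z)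
open import Algebra.Properties.CommutativeSemigroup *-commutativeSemigroup using (x∙yz≈y∙xz)
open import Data.Nat.Primality using (Prime; prime?)
open import Data.Product as Product using (_×_; _,_)
open import Data.Rational as ℚ using (ℚ; 1ℚ; toℚᵘ) renaming (_≤_ to _≤ℚ_)
open import Data.Rational.Properties
  using (toℚᵘ-fromℚᵘ; toℚᵘ-homo-*; toℚᵘ-homo-+; toℚᵘ-homo‿-; toℚᵘ-cancel-≤)
open import Data.Rational.Unnormalised as ℚᵘ using (mkℚᵘ; *≤*; _≃_)
open import Data.Rational.Unnormalised.Properties as ℚᵘ
  using (≃-refl; ≃-sym; ≃-trans; ≃-reflexive; *-cong; +-congʳ; -‿cong)
open import Data.Sum as Sum using (_⊎_; inj₁; inj₂)
open import Data.Vec as Vec using (Vec; []; _∷_)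
open import Function using (_∘_)
open import Relation.Binary.PropositionalEquality
open import Relation.Nullary using (¬_; Dec; yes; no; ¬?; does; contradiction)
open import Relation.Nullary.Decidable using (_×-dec_)

m∸n≡m∸[1+n]⊎1+[m∸[1+n]] : ∀ m n → m ∸ n ≡ m ∸ suc n ⊎ m ∸ n ≡ suc (m ∸ suc n)
m∸n≡m∸[1+n]⊎1+[m∸[1+n]] m n with m ∸ n | pred[m∸n]≡m∸[1+n] m n
... | zero  | eq = inj₁ eq
... | suc _ | eq = inj₂ (cong suc eq)

windowSum : (ℕ → ℕ) → ℕ → ℕ
windowSum a zero    = 0
windowSum a (suc m) = a 1 + windowSum (a ∘ suc) m

sum-applyUpTo≡windowSum : ∀ (a : ℕ → ℕ) m → sum (applyUpTo (a ∘ suc) m) ≡ windowSum a m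
sum-applyUpTo≡windowSum a zero    = refl
sum-applyUpTo≡windowSum a (suc m) = cong (a 1 +_) (sum-applyUpTo≡windowSum (a ∘ suc) m)

length-filter-concatMap : ∀ {A B : Set} {P : B → Set} (P? : ∀ y → Dec (P y))
                          (f : A → List B) (g : A → ℕ) →
                          (∀ x → length (filter P? (f x)) ≡ g x) →
                          ∀ xs → length (filter P? (concatMap f xs)) ≡ sum (map g xs)
length-filter-concatMap P? f g fg [] = refl
length-filter-concatMap P? f g fg (x ∷ xs) = begin
  length (filter P? (f x List.++ concatMap f xs))
    ≡⟨ cong length (filter-++ P? (f x) (concatMap f xs)) ⟩
  length (filter P? (f x) List.++ filter P? (concatMap f xs))
    ≡⟨ length-++ (filter P? (f x)) ⟩
  length (filter P? (f x)) + length (filter P? (concatMap f xs))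
    ≡⟨ cong₂ _+_ (fg x) (length-filter-concatMap P? f g fg xs) ⟩
  g x + sum (map g xs) ∎
  where open ≡-Reasoning

module _ (c : ℕ) where

  private
    M : ℕ
    M = suc c

  step-past-prime : ∀ {m} x B e → m ≤ c → x * M ^ e ≤ m * (B * c ^ e) →
                    x * M ^ suc e ≤ suc m * (B * c ^ suc e)
  step-past-prime {m} x B e m≤c bound = begin
    x * (M * M ^ e)           ≡⟨ x∙yz≈y∙xz x M (M ^ e) ⟩
    M * (x * M ^ e)           ≤⟨ *-monoʳ-≤ M bound ⟩
    M * (m * (B * c ^ e))     ≡⟨ sym (*-assoc M m _) ⟩
    (M * m) * (B * c ^ e)     ≤⟨ *-monoˡ-≤ (B * c ^ e) (M*m≤[1+m]*c) ⟩
    (suc m * c) * (B * c ^ e) ≡⟨ *-assoc (suc m) c _ ⟩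
    suc m * (c * (B * c ^ e)) ≡⟨ cong (suc m *_) (x∙yz≈y∙xz c B (c ^ e)) ⟩
    suc m * (B * (c * c ^ e)) ∎
    where
      open ≤-Reasoning
      M*m≤[1+m]*c : M * m ≤ suc m * c
      M*m≤[1+m]*c = begin
        m + c * m ≤⟨ +-monoˡ-≤ (c * m) m≤c ⟩
        c + c * m ≡⟨ cong (c +_) (*-comm c m) ⟩
        c + m * c ∎

  window-bound : ∀ B (a e : ℕ → ℕ) →
                 (∀ q → e q ≡ e (suc q) ⊎ (a (suc q) ≡ 0 × e q ≡ suc (e (suc q)))) →
                 (∀ q → a q * M ^ e q ≤ B * c ^ e q) →
                 ∀ m → m ≤ M → windowSum a m * M ^ e 0 ≤ m * (B * c ^ e 0)
  window-bound B a e e-step a-bound zero    _     = z≤n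
  window-bound B a e e-step a-bound (suc m) 1+m≤M
    with e-step 0 | window-bound B (a ∘ suc) (e ∘ suc) (e-step ∘ suc) (a-bound ∘ suc) m (<⇒≤ 1+m≤M)
  ... | inj₁ e0≡e1 | rest-bound rewrite e0≡e1 = begin
    (a 1 + windowSum (a ∘ suc) m) * M ^ e 1
      ≡⟨ *-distribʳ-+ (M ^ e 1) (a 1) (windowSum (a ∘ suc) m) ⟩
    a 1 * M ^ e 1 + windowSum (a ∘ suc) m * M ^ e 1
      ≤⟨ +-mono-≤ (a-bound 1) rest-bound ⟩
    B * c ^ e 1 + m * (B * c ^ e 1) ∎
    where open ≤-Reasoning
  ... | inj₂ (a1≡0 , e0≡1+e1) | rest-bound rewrite e0≡1+e1 | a1≡0 =
    step-past-prime (windowSum (a ∘ suc) m) B (e 1) (≤-pred 1+m≤M) rest-bound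

primeCount-suc : ∀ p → primeCount (suc p) ≡ primeCount p + length (filter prime? (suc p ∷ []))
primeCount-suc p = begin
  length (filter prime? (applyUpTo suc (suc p)))
    ≡⟨ cong (length ∘ filter prime?) (sym (applyUpTo-∷ʳ suc p)) ⟩
  length (filter prime? (applyUpTo suc p List.++ suc p ∷ []))
    ≡⟨ cong length (filter-++ prime? (applyUpTo suc p) (suc p ∷ [])) ⟩
  length (filter prime? (applyUpTo suc p) List.++ filter prime? (suc p ∷ []))
    ≡⟨ length-++ (filter prime? (applyUpTo suc p)) ⟩
  primeCount p + length (filter prime? (suc p ∷ [])) ∎
  where open ≡-Reasoning

primeCount-suc-prime : ∀ {p} → Prime (suc p) → primeCount (suc p) ≡ suc (primeCount p)
primeCount-suc-prime {p} pr = begin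
  primeCount (suc p)
    ≡⟨ primeCount-suc p ⟩
  primeCount p + length (filter prime? (suc p ∷ []))
    ≡⟨ cong (λ xs → primeCount p + length xs) (filter-accept prime? pr) ⟩
  primeCount p + 1
    ≡⟨ +-comm (primeCount p) 1 ⟩
  suc (primeCount p) ∎
  where open ≡-Reasoning

primeCount-suc-composite : ∀ {p} → ¬ Prime (suc p) → primeCount (suc p) ≡ primeCount p
primeCount-suc-composite {p} ¬pr = begin
  primeCount (suc p)
    ≡⟨ primeCount-suc p ⟩
  primeCount p + length (filter prime? (suc p ∷ []))
    ≡⟨ cong (λ xs → primeCount p + length xs) (filter-reject prime? ¬pr) ⟩
  primeCount p + 0
    ≡⟨ +-identityʳ (primeCount p) ⟩
  primeCount p ∎
  where open ≡-Reasoning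

primesBetween : ℕ → ℕ → ℕ
primesBetween p k = primeCount k ∸ primeCount p

primesBetween-suc : ∀ p k → primesBetween p k ≡ primesBetween (suc p) k
                          ⊎ (Prime (suc p) × primesBetween p k ≡ suc (primesBetween (suc p) k))
primesBetween-suc p k with prime? (suc p)
... | no ¬pr = inj₁ (cong (primeCount k ∸_) (sym (primeCount-suc-composite ¬pr)))
... | yes pr rewrite primeCount-suc-prime pr =
  Sum.map₂ (pr ,_) (m∸n≡m∸[1+n]⊎1+[m∸[1+n]] (primeCount k) (primeCount p))

module _ (k : ℕ) where

  -- Positions are x + s rather than s + x so that shifting the start of a walk is definitional.
  PrimeFreeWalk : ∀ {n} → ℕ → Vec ℕ n → Set
  PrimeFreeWalk s []      = s ≡ k
  PrimeFreeWalk s (x ∷ η) = ¬ Prime (x + s) × PrimeFreeWalk (x + s) η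

  primeFreeWalk? : ∀ {n} s (η : Vec ℕ n) → Dec (PrimeFreeWalk s η)
  primeFreeWalk? s []      = s ≟ k
  primeFreeWalk? s (x ∷ η) = ¬? (prime? (x + s)) ×-dec primeFreeWalk? (x + s) η

  walks : (M n s : ℕ) → ℕ
  walks M n s = length (filter (primeFreeWalk? s) (tuples M n))

  walksThrough : (M n q : ℕ) → ℕ
  walksThrough M n q = if does (prime? q) then 0 else walks M n q

  walksThrough-prime : ∀ M n {q} → Prime q → walksThrough M n q ≡ 0
  walksThrough-prime M n {q} pr with prime? q
  ... | yes _   = refl
  ... | no  ¬pr = contradiction pr ¬pr

  length-filter-walk-∷ : ∀ {n} x s (ηs : List (Vec ℕ n)) →
                         length (filter (primeFreeWalk? s) (map (x ∷_) ηs))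
                         ≡ (if does (prime? (x + s)) then 0 else length (filter (primeFreeWalk? (x + s)) ηs))
  length-filter-walk-∷ x s [] with prime? (x + s)
  ... | yes _ = refl
  ... | no  _ = refl
  length-filter-walk-∷ x s (η ∷ ηs)
    with prime? (x + s) | primeFreeWalk? (x + s) η | length-filter-walk-∷ x s ηs
  ... | yes _ | _     | ih = ih
  ... | no  _ | yes _ | ih = cong suc ih
  ... | no  _ | no  _ | ih = ih

  walks-suc : ∀ M n s → walks M (suc n) s ≡ windowSum (λ q → walksThrough M n (q + s)) M
  walks-suc M n s = begin
    length (filter (primeFreeWalk? s) (concatMap (λ x → map (x ∷_) (tuples M n)) (applyUpTo suc M)))
      ≡⟨ length-filter-concatMap (primeFreeWalk? s) (λ x → map (x ∷_) (tuples M n)) through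
           (λ x → length-filter-walk-∷ x s (tuples M n)) (applyUpTo suc M) ⟩
    sum (map through (applyUpTo suc M))
      ≡⟨ cong sum (map-applyUpTo suc through M) ⟩
    sum (applyUpTo (through ∘ suc) M)
      ≡⟨ sum-applyUpTo≡windowSum through M ⟩
    windowSum through M ∎
    where
      open ≡-Reasoning
      through : ℕ → ℕ
      through x = walksThrough M n (x + s)

  module _ (c : ℕ) where

    private
      M : ℕ
      M = suc c

    walks-bound : ∀ n s → walks M n s * M ^ primesBetween s k ≤ M ^ n * c ^ primesBetween s k
    walks-bound zero s with s ≟ k
    ... | yes refl rewrite filter-accept (primeFreeWalk? k) {xs = []} (refl {x = k})
                         | n∸n≡0 (primeCount k) = ≤-refl
    ... | no  s≢k  rewrite filter-reject (primeFreeWalk? s) {xs = []} s≢k = z≤n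
    walks-bound (suc n) s rewrite walks-suc M n s | *-assoc M (M ^ n) (c ^ primesBetween s k) =
      window-bound c (M ^ n) (λ q → walksThrough M n (q + s)) (λ q → primesBetween (q + s) k)
                   (λ q → step (q + s)) (λ q → through-bound (q + s)) M ≤-refl
      where
        step : ∀ p → primesBetween p k ≡ primesBetween (suc p) k
                   ⊎ (walksThrough M n (suc p) ≡ 0 × primesBetween p k ≡ suc (primesBetween (suc p) k))
        step p = Sum.map₂ (Product.map₁ (walksThrough-prime M n)) (primesBetween-suc p k)
        through-bound : ∀ q → walksThrough M n q * M ^ primesBetween q k ≤ M ^ n * c ^ primesBetween q k
        through-bound q with prime? q
        ... | yes _ = z≤n
        ... | no  _ = walks-bound n q

  prefixes⇒primeFreeWalk : ∀ {n} s (η : Vec ℕ n) →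
                           (∀ ℓ → 1 ≤ ℓ → ℓ ≤ n → ¬ Prime (partialSum ℓ η + s)) →
                           Vec.sum η + s ≡ k → PrimeFreeWalk s η
  prefixes⇒primeFreeWalk s []      _      end≡k = end≡k
  prefixes⇒primeFreeWalk s (x ∷ η) prefix end≡k =
    first , prefixes⇒primeFreeWalk (x + s) η rest (trans (x∙yz≈yx∙z (Vec.sum η) x s) end≡k)
    where
      first : ¬ Prime (x + s)
      first = subst (λ y → ¬ Prime (y + s)) (+-identityʳ x) (prefix 1 ≤-refl (s≤s z≤n))
      rest : ∀ ℓ → 1 ≤ ℓ → ℓ ≤ _ → ¬ Prime (partialSum ℓ η + (x + s))
      rest ℓ _ ℓ≤n = subst (¬_ ∘ Prime) (sym (x∙yz≈yx∙z (partialSum ℓ η) x s))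
                           (prefix (suc ℓ) (s≤s z≤n) (s≤s ℓ≤n))

  partialSum-all : ∀ {n} (η : Vec ℕ n) → partialSum n η ≡ Vec.sum η
  partialSum-all []      = refl
  partialSum-all (x ∷ η) = cong (x +_) (partialSum-all η)

  good⇒primeFreeWalk : ∀ {r} (η : Vec ℕ r) → ¬ Prime k → Good k η → PrimeFreeWalk 0 η
  good⇒primeFreeWalk {r} η k-composite (noPrimePrefix , sum≡k) =
    prefixes⇒primeFreeWalk 0 η prefix (trans (+-identityʳ (Vec.sum η)) sum≡k)
    where
      prefix : ∀ ℓ → 1 ≤ ℓ → ℓ ≤ r → ¬ Prime (partialSum ℓ η + 0)
      prefix ℓ 1≤ℓ ℓ≤r rewrite +-identityʳ (partialSum ℓ η) with m≤n⇒m<n∨m≡n ℓ≤r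
      ... | inj₁ ℓ<r  = noPrimePrefix ℓ 1≤ℓ ℓ<r
      ... | inj₂ refl rewrite partialSum-all η | sum≡k = k-composite

  countGood≤walks : ∀ M r → ¬ Prime k → countGood M r k ≤ walks M r 0
  countGood≤walks M r k-composite =
    length-mono-≤ (filter⁺ (good? k) (primeFreeWalk? 0) (λ { refl → good⇒primeFreeWalk _ k-composite })
                           (⊆-refl {x = tuples M r}))

toℚᵘ-/ : ∀ a d .{{_ : NonZero d}} → toℚᵘ (ℤ.+ a ℚ./ d) ≃ ℤ.+ a ℚᵘ./ d
toℚᵘ-/ a (suc d) = toℚᵘ-fromℚᵘ (mkℚᵘ (ℤ.+ a) d)

/-*-/ : ∀ a b a′ b′ .{{_ : NonZero b}} .{{_ : NonZero b′}} .{{_ : NonZero (b * b′)}} →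
        (ℤ.+ a ℚᵘ./ b) ℚᵘ.* (ℤ.+ a′ ℚᵘ./ b′) ≃ ℤ.+ (a * a′) ℚᵘ./ (b * b′)
/-*-/ a (suc b) a′ (suc b′) = ≃-reflexive (cong (λ n → mkℚᵘ n _) (sym (pos-* a a′)))

/-mono-≤ : ∀ {a b a′ b′} .{{_ : NonZero b}} .{{_ : NonZero b′}} →
           a * b′ ≤ a′ * b → ℤ.+ a ℚᵘ./ b ℚᵘ.≤ ℤ.+ a′ ℚᵘ./ b′
/-mono-≤ {a} {suc b} {a′} {suc b′} le =
  *≤* (subst₂ ℤ._≤_ (pos-* a (suc b′)) (pos-* a′ (suc b)) (ℤ.+≤+ le))

toℚᵘ-oneMinusInv : ∀ c → toℚᵘ (oneMinusInv (suc c)) ≃ ℤ.+ c ℚᵘ./ suc c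
toℚᵘ-oneMinusInv c = begin
  toℚᵘ (1ℚ ℚ.+ ℚ.- 1/M)
    ≈⟨ toℚᵘ-homo-+ 1ℚ (ℚ.- 1/M) ⟩
  toℚᵘ 1ℚ ℚᵘ.+ toℚᵘ (ℚ.- 1/M)
    ≈⟨ +-congʳ (toℚᵘ 1ℚ) (≃-trans (toℚᵘ-homo‿- 1/M) (-‿cong (toℚᵘ-/ 1 (suc c)))) ⟩
  ℚᵘ.1ℚᵘ ℚᵘ.+ ℚᵘ.- (ℤ.+ 1 ℚᵘ./ suc c)
    ≡⟨ 1-1/[1+c] ⟩
  ℤ.+ c ℚᵘ./ suc c ∎
  where
    open ℚᵘ.≃-Reasoning
    1/M : ℚ
    1/M = ℤ.+ 1 ℚ./ suc c
    1-1/[1+c] : ℚᵘ.1ℚᵘ ℚᵘ.+ ℚᵘ.- (ℤ.+ 1 ℚᵘ./ suc c) ≡ ℤ.+ c ℚᵘ./ suc c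
    1-1/[1+c] rewrite +-identityʳ c = refl

toℚᵘ-oneMinusInv-^ : ∀ c n → toℚᵘ (oneMinusInv (suc c) ^ℚ n)
                            ≃ (ℤ.+ (c ^ n) ℚᵘ./ (suc c ^ n)) {{m^n≢0 (suc c) n}}
toℚᵘ-oneMinusInv-^ c zero    = ≃-refl
toℚᵘ-oneMinusInv-^ c (suc n) = begin
  toℚᵘ (q ℚ.* q ^ℚ n)
    ≈⟨ toℚᵘ-homo-* q (q ^ℚ n) ⟩
  toℚᵘ q ℚᵘ.* toℚᵘ (q ^ℚ n)
    ≈⟨ *-cong (toℚᵘ-oneMinusInv c) (toℚᵘ-oneMinusInv-^ c n) ⟩
  (ℤ.+ c ℚᵘ./ suc c) ℚᵘ.* (ℤ.+ (c ^ n) ℚᵘ./ (suc c ^ n))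
    ≈⟨ /-*-/ c (suc c) (c ^ n) (suc c ^ n) ⟩
  ℤ.+ (c ^ suc n) ℚᵘ./ (suc c ^ suc n) ∎
  where
    open ℚᵘ.≃-Reasoning
    q : ℚ
    q = oneMinusInv (suc c)
    instance
      M^n≢0 : NonZero (suc c ^ n)
      M^n≢0 = m^n≢0 (suc c) n
      M^1+n≢0 : NonZero (suc c ^ suc n)
      M^1+n≢0 = m^n≢0 (suc c) (suc n)

countGood-bound : ∀ c r k → ¬ Prime k →
                  countGood (suc c) r k * suc c ^ primeCount k ≤ c ^ primeCount k * suc c ^ r
countGood-bound c r k k-composite = begin
  countGood (suc c) r k * suc c ^ π ≤⟨ *-monoˡ-≤ _ (countGood≤walks k (suc c) r k-composite) ⟩
  walks k (suc c) r 0 * suc c ^ π   ≤⟨ walks-bound k c r 0 ⟩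
  suc c ^ r * c ^ π                ≡⟨ *-comm (suc c ^ r) _ ⟩
  c ^ π * suc c ^ r                ∎
  where
    open ≤-Reasoning
    π : ℕ
    π = primeCount k

-- The bound holds without the hypotheses r ≥ 1 and r ≤ k ≤ M r.
lemma4 : (M : ℕ) .{{_ : NonZero M}} → (r k : ℕ) → 1 ≤ r →
         ¬ Prime k → r ≤ k → k ≤ M * r →
         Pr M r k ≤ℚ (oneMinusInv M ^ℚ primeCount k)
lemma4 (suc c) r k _ k-composite _ _ = toℚᵘ-cancel-≤ (begin
  toℚᵘ (Pr (suc c) r k)                      ≃⟨ toℚᵘ-/ (countGood (suc c) r k) (suc c ^ r) ⟩
  ℤ.+ (countGood (suc c) r k) ℚᵘ./ suc c ^ r ≤⟨ /-mono-≤ (countGood-bound c r k k-composite) ⟩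
  ℤ.+ (c ^ π) ℚᵘ./ suc c ^ π                 ≃⟨ ≃-sym (toℚᵘ-oneMinusInv-^ c π) ⟩
  toℚᵘ (oneMinusInv (suc c) ^ℚ π)            ∎)
  where
    open ℚᵘ.≤-Reasoning
    π : ℕ
    π = primeCount k
    instance
      M^r≢0 : NonZero (suc c ^ r)
      M^r≢0 = m^n≢0 (suc c) r
      M^π≢0 : NonZero (suc c ^ π)
      M^π≢0 = m^n≢0 (suc c) π
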